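{- Let $\Delta=\bigsqcup_{i\in\mathbb Z}\Delta(i)$ be a $\mathbb Z$-grading of an irreducible reduced crystallographic root system with compatible positive system $\Delta^+=\Delta(0)^+\sqcup\Delta(1)\sqcup\Delta(2)\sqcup\cdots$. If $I$ is a lower ideal of $(\Delta(1),\preccurlyeq)$, then $\langle I\rangle=\bigcup_{k\ge1}I^k$ is a bi-convex subset of $\Delta^+$, i.e., both $\langle I\rangle$ and $\Delta^+\setminus\langle I\rangle$ are closed under addition (within $\Delta$).
   Context: A $\mathbb Z$-grading of $\Delta$ is a disjoint decomposition $\Delta=\bigsqcup_{i\in\mathbb Z}\Delta(i)$ such that whenever $\gamma_1\in\Delta(i_1)$, $\gamma_2\in\Delta(i_2)$ and $\gamma_1+\gamma_2\in\Delta$, then $\gamma_1+\gamma_2\in\Delta(i_1+i_2)$; compatibility means $\Delta^+=\Delta(0)^+\sqcup\bigsqcup_{i\ge1}\Delta(i)$ with $\Delta(0)^+$ a positive system of the root system $\Delta(0)$. The order: $\mu\preccurlyeq\gamma$ iff $\gamma-\mu$ is a nonnegative integer combination of simple roots; $\Delta(1)$ carries the restricted order; a lower ideal is a downward closed subset. For $I\subset\Delta^+$: $I^1=I$, $I^k=(I+I^{k-1})\cap\Delta$ for $k\ge2$, $\langle I\rangle=\bigcup_{k\ge1}I^k$. A subset $M\subset\Delta^+$ is closed if $\gamma_1,\gamma_2\in M$, $\gamma_1+\gamma_2\in\Delta$ imply $\gamma_1+\gamma_2\in M$. -}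

module Defs where

open import Data.Nat using (ℕ; zero; suc)
open import Data.Integer using (ℤ; +_; _+_; _-_; _*_; -_; _≤_; _<_)
open import Data.Fin using (Fin; zero; suc)
import Data.Fin as Fin
open import Data.Bool using (Bool; true; false; if_then_else_)
open import Data.Vec using (Vec; zipWith; map; tabulate; lookup; replicate)
open import Data.Vec.Relation.Unary.All using (All)
open import Data.Product using (Σ; ∃; ∃-syntax; _×_; _,_)
open import Data.Sum using (_⊎_)
open import Data.Empty using (⊥)
open import Relation.Nullary using (¬_)
open import Relation.Nullary.Decidable using (⌊_⌋)
open import Relation.Binary.PropositionalEquality using (_≡_; _≢_)

-- Vectors in the root lattice ℤ^n, written in coordinates w.r.t. the simple roots.
Pred : ℕ → Set₁
Pred n = Vec ℤ n → Set

_+ᵥ_ : ∀ {n} → Vec ℤ n → Vec ℤ n → Vec ℤ n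
_+ᵥ_ = zipWith _+_

_-ᵥ_ : ∀ {n} → Vec ℤ n → Vec ℤ n → Vec ℤ n
_-ᵥ_ = zipWith _-_

negᵥ : ∀ {n} → Vec ℤ n → Vec ℤ n
negᵥ = map (λ x → - x)

_·ᵥ_ : ∀ {n} → ℤ → Vec ℤ n → Vec ℤ n
c ·ᵥ v = map (c *_) v

e : ∀ {n} → Fin n → Vec ℤ n
e i = tabulate (λ j → if ⌊ i Fin.≟ j ⌋ then + 1 else + 0)

∑ : ∀ {n} → (Fin n → ℤ) → ℤ
∑ {zero} f = + 0
∑ {suc n} f = f zero + ∑ (λ i → f (suc i))

Matrix : ℕ → Set
Matrix n = Fin n → Fin n → ℤ

-- Convention: A i j = ⟨α_i , α_j^∨⟩.
-- ⟨β , α_j^∨⟩ for β = Σ β_i α_i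
pairing : ∀ {n} → Matrix n → Vec ℤ n → Fin n → ℤ
pairing A β j = ∑ (λ i → lookup β i * A i j)

refl-s : ∀ {n} → Matrix n → Fin n → Vec ℤ n → Vec ℤ n
refl-s A j β = β -ᵥ (pairing A β j ·ᵥ e j)

-- Cartan matrix of an irreducible reduced crystallographic (finite) root system:
-- generalized Cartan matrix, symmetrizable with positive-definite symmetrization,
-- indecomposable, of rank n ≥ 1.
record IsIrreducibleFiniteCartan (n : ℕ) (A : Matrix n) : Set where
  field
    rank-pos   : 1 Data.Nat.≤ n
    diag       : ∀ i → A i i ≡ + 2
    offdiag    : ∀ i j → i ≢ j → A i j ≤ + 0
    zero-sym   : ∀ i j → A i j ≡ + 0 → A j i ≡ + 0
    d          : Fin n → ℕ
    d-pos      : ∀ i → 1 Data.Nat.≤ d i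
    symmetric  : ∀ i j → (+ d i) * A i j ≡ (+ d j) * A j i
    pos-def    : ∀ (x : Vec ℤ n) → x ≢ replicate n (+ 0) →
                 + 0 < ∑ (λ i → ∑ (λ j → lookup x i * (+ d i) * A i j * lookup x j))
    connected  : ∀ (S : Fin n → Bool) → (∃[ i ] S i ≡ true) → (∃[ j ] S j ≡ false) →
                 ∃[ i ] ∃[ j ] (S i ≡ true × S j ≡ false × A i j ≢ + 0)

-- The root system Δ: Weyl group orbit of the simple roots.
data Root {n : ℕ} (A : Matrix n) : Vec ℤ n → Set where
  simple  : ∀ i → Root A (e i)
  reflect : ∀ j β → Root A β → Root A (refl-s A j β)

Positive : ∀ {n} → Matrix n → Pred n
Positive A γ = Root A γ × All (+ 0 ≤_) γ

_≼_ : ∀ {n} → Vec ℤ n → Vec ℤ n → Set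
μ ≼ γ = All (+ 0 ≤_) (γ -ᵥ μ)

IsGrading : ∀ {n} → Matrix n → (Vec ℤ n → ℤ) → Set
IsGrading A g = ∀ γ₁ γ₂ → Root A γ₁ → Root A γ₂ → Root A (γ₁ +ᵥ γ₂) →
                g (γ₁ +ᵥ γ₂) ≡ g γ₁ + g γ₂

Deg : ∀ {n} → Matrix n → (Vec ℤ n → ℤ) → ℤ → Pred n
Deg A g i γ = Root A γ × g γ ≡ i

Closed : ∀ {n} → Matrix n → Pred n → Set
Closed A M = ∀ γ₁ γ₂ → M γ₁ → M γ₂ → Root A (γ₁ +ᵥ γ₂) → M (γ₁ +ᵥ γ₂)

IsPositiveSystemOf : ∀ {n} → Pred n → Pred n → Set
IsPositiveSystemOf Φ P =
  (∀ γ → Φ γ → Φ (negᵥ γ)) ×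
  (∀ γ → P γ → Φ γ) ×
  (∀ γ → Φ γ → P γ ⊎ P (negᵥ γ)) ×
  (∀ γ → P γ → P (negᵥ γ) → ⊥) ×
  (∀ γ₁ γ₂ → P γ₁ → P γ₂ → Φ (γ₁ +ᵥ γ₂) → P (γ₁ +ᵥ γ₂))

IsCompatible : ∀ {n} → Matrix n → (Vec ℤ n → ℤ) → Set
IsCompatible A g =
  (∀ γ → Positive A γ → + 0 ≤ g γ) ×
  (∀ γ → Root A γ → + 1 ≤ g γ → Positive A γ) ×
  IsPositiveSystemOf (Deg A g (+ 0)) (λ γ → Deg A g (+ 0) γ × Positive A γ)

IsLowerIdeal : ∀ {n} → Matrix n → (Vec ℤ n → ℤ) → Pred n → Set
IsLowerIdeal A g I =
  (∀ γ → I γ → Deg A g (+ 1) γ) ×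
  (∀ γ μ → I γ → Deg A g (+ 1) μ → μ ≼ γ → I μ)

-- IPow A I k  is  I^(k+1):  I^1 = I, I^(k+1) = (I + I^k) ∩ Δ
IPow : ∀ {n} → Matrix n → Pred n → ℕ → Pred n
IPow A I zero γ = I γ
IPow A I (suc k) γ = ∃[ α ] ∃[ β ] (I α × IPow A I k β × γ ≡ α +ᵥ β × Root A γ)

Gen : ∀ {n} → Matrix n → Pred n → Pred n
Gen A I γ = ∃[ k ] IPow A I k γ

IsBiconvex : ∀ {n} → Matrix n → Pred n → Set
IsBiconvex A M =
  (∀ γ → M γ → Positive A γ) ×
  Closed A M ×
  Closed A (λ γ → Positive A γ × ¬ M γ)

module Submission where

-- The argument is metric.  From the symmetrisation of the Cartan matrix we build a
-- Weyl-invariant, positive-definite integral form ⟪_,_⟫ on the root lattice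
-- (module InvariantForm).  Invariance and definiteness give (module RootGeometry):
--   * for roots x ≠ y with ⟪x,y⟫ > 0 the difference x - y is a root, and for roots
--     x ≠ -y with ⟪x,y⟫ < 0 the sum x + y is a root;
--   * the three-root lemma: if α, β, γ ∈ Δ⁺ and α+β, α+β+γ ∈ Δ then α+γ ∈ Δ or β+γ ∈ Δ.
-- Compatibility of the grading makes every root difference positive or negative
-- (module CompatibleGrading).  Finally (module GeneratedIdeal) ⟨I⟩ ⊆ Δ⁺ since I^k lies
-- in degree k; ⟨I⟩ is closed by induction on k via the three-root lemma; and Δ⁺ ∖ ⟨I⟩
-- is closed because a splitting of an element of I^(k+1) into two positive roots outside
-- ⟨I⟩ can be exchanged, through a root x - y with ⟪x,y⟫ > 0, for such a splitting of an
-- element of I or of I^k, while for I itself degrees and the lower-ideal property forbid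
-- it.

open import Defs
open import Data.Nat using (ℕ)
open import Data.Integer using (ℤ)
open import Data.Vec using (Vec)

import Data.Nat as ℕ
import Data.Nat.Properties as ℕP
open import Data.Integer using (+_; +[1+_]; -[1+_]; _+_; _-_; _*_; -_; _≤_; _<_; +≤+; +<+)
import Data.Integer as ℤ
import Data.Integer.Properties as ℤP
open import Data.Integer.Tactic.RingSolver using (solve-∀)
open import Data.Fin using (Fin; zero; suc; punchIn)
import Data.Fin as Fin
open import Data.Bool using (if_then_else_)
open import Data.Vec using ([]; _∷_; lookup; tabulate; replicate)
import Data.Vec.Properties as VecP
open import Data.Vec.Functional using (removeAt)
open import Data.Vec.Relation.Unary.All using (All; []; _∷_)
open import Data.Product using (∃-syntax; _×_; _,_; proj₁; proj₂)
open import Data.Sum using (_⊎_; inj₁; inj₂; [_,_]′)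
import Data.Sum as Sum
open import Data.Empty using (⊥; ⊥-elim)
open import Relation.Nullary using (¬_; Dec; yes; no)
open import Relation.Nullary.Decidable using (⌊_⌋)
open import Relation.Binary using (tri<; tri≈; tri>)
open import Function using (id)
open import Relation.Binary.PropositionalEquality
open ≡-Reasoning
import Algebra.Properties.Semiring.Sum ℤP.+-*-semiring as ℤSum
import Algebra.Properties.CommutativeMonoid.Sum ℕP.*-1-commutativeMonoid as ℕProduct

cancel-pos : ∀ {k a b} → + 0 < k → k * a ≡ k * b → a ≡ b
cancel-pos {k} {a} {b} 0<k = ℤP.*-cancelˡ-≡ k a b {{ℤ.>-nonZero 0<k}}

positive-summand : ∀ a b → + 0 < a + b → + 0 < a ⊎ + 0 < b
positive-summand a b 0<a+b with a ℤP.≤? + 0 | b ℤP.≤? + 0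
... | no a≰0  | _       = inj₁ (ℤP.≰⇒> a≰0)
... | yes _   | no b≰0  = inj₂ (ℤP.≰⇒> b≰0)
... | yes a≤0 | yes b≤0 = ⊥-elim (ℤP.<-irrefl refl (ℤP.<-≤-trans 0<a+b (ℤP.+-mono-≤ a≤0 b≤0)))

negative-summand : ∀ a b → a + b < + 0 → a < + 0 ⊎ b < + 0
negative-summand a b a+b<0 with a ℤP.<? + 0 | b ℤP.<? + 0
... | yes a<0 | _       = inj₁ a<0
... | no _    | yes b<0 = inj₂ b<0
... | no a≮0  | no b≮0  =
  ⊥-elim (ℤP.<-irrefl refl (ℤP.≤-<-trans (ℤP.+-mono-≤ (ℤP.≮⇒≥ a≮0) (ℤP.≮⇒≥ b≮0)) a+b<0))

negative-complement : ∀ {a b} → + 0 < a → a + b ≤ + 0 → b < + 0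
negative-complement {a} {b} 0<a a+b≤0 with b ℤP.<? + 0
... | yes b<0 = b<0
... | no b≮0  = ⊥-elim (ℤP.<-irrefl refl (ℤP.<-≤-trans (ℤP.+-mono-<-≤ 0<a (ℤP.≮⇒≥ b≮0)) a+b≤0))

split-one : ∀ {a b} → + 0 ≤ a → + 0 ≤ b → a + b ≡ + 1 →
            (a ≡ + 0 × b ≡ + 1) ⊎ (a ≡ + 1 × b ≡ + 0)
split-one {+ 0}               {+ _}       _ _ a+b≡1 = inj₁ (refl , a+b≡1)
split-one {+ 1}               {+ 0}       _ _ _     = inj₂ (refl , refl)
split-one {+ 1}               {+ ℕ.suc _} _ _ ()
split-one {+ ℕ.suc (ℕ.suc _)} {+ _}       _ _ ()

-- If 2c = p·b with b, c > 0 and p ≠ 1, then the integer p is at least 2, hence b ≤ c.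
-- Applied to a reflection coefficient p = 2⟪x,y⟫/⟪y,y⟫ this bounds ⟪y,y⟫ by ⟪x,y⟫.
coefficient-bound : ∀ {b c} p → + 0 < b → + 0 < c → + 2 * c ≡ p * b → p ≢ + 1 → b ≤ c
coefficient-bound {+ 0}      {_}        _     (+<+ ()) _ _ _
coefficient-bound {_}        {+ 0}      _     _ (+<+ ()) _ _
coefficient-bound {+[1+ _ ]} {+[1+ _ ]} (+ 0)                 _ _ () _
coefficient-bound {+[1+ _ ]} {+[1+ _ ]} (+ 1)                 _ _ _  p≢1 = ⊥-elim (p≢1 refl)
coefficient-bound {+[1+ _ ]} {+[1+ _ ]} -[1+ _ ]              _ _ () _
coefficient-bound {b@(+[1+ _ ])} {c@(+[1+ _ ])} p@(+ ℕ.suc (ℕ.suc _)) _ _ 2c≡pb _ =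
  ℤP.*-cancelˡ-≤-pos b c (+ 2)
    (subst (+ 2 * b ≤_) (sym 2c≡pb) (ℤP.*-monoʳ-≤-nonNeg b {+ 2} {p} (+≤+ (ℕ.s≤s (ℕ.s≤s ℕ.z≤n)))))

0ᵥ : ∀ {m} → Vec ℤ m
0ᵥ = replicate _ (+ 0)

vext : ∀ {m} {x y : Vec ℤ m} → (∀ i → lookup x i ≡ lookup y i) → x ≡ y
vext {x = x} {y} x≗y = trans (sym (VecP.tabulate∘lookup x))
                             (trans (VecP.tabulate-cong x≗y) (VecP.tabulate∘lookup y))

+ᵥ-comm : ∀ {m} (x y : Vec ℤ m) → x +ᵥ y ≡ y +ᵥ x
+ᵥ-comm = VecP.zipWith-comm ℤP.+-comm

+ᵥ-assoc : ∀ {m} (x y z : Vec ℤ m) → (x +ᵥ y) +ᵥ z ≡ x +ᵥ (y +ᵥ z)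
+ᵥ-assoc = VecP.zipWith-assoc ℤP.+-assoc

+ᵥ-cancelˡ : ∀ {m} (x y : Vec ℤ m) → (x +ᵥ y) -ᵥ x ≡ y
+ᵥ-cancelˡ []      []      = refl
+ᵥ-cancelˡ (a ∷ x) (b ∷ y) = cong₂ _∷_ (scalar a b) (+ᵥ-cancelˡ x y)
  where scalar : ∀ a b → (a + b) - a ≡ b
        scalar = solve-∀

+ᵥ-cancelʳ : ∀ {m} (x y : Vec ℤ m) → (x +ᵥ y) -ᵥ y ≡ x
+ᵥ-cancelʳ x y = trans (cong (_-ᵥ y) (+ᵥ-comm x y)) (+ᵥ-cancelˡ y x)

-ᵥ-self : ∀ {m} (x : Vec ℤ m) → x -ᵥ x ≡ 0ᵥ
-ᵥ-self []      = refl
-ᵥ-self (a ∷ x) = cong₂ _∷_ (ℤP.+-inverseʳ a) (-ᵥ-self x)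

negᵥ-inverseˡ : ∀ {m} (x : Vec ℤ m) → negᵥ x +ᵥ x ≡ 0ᵥ
negᵥ-inverseˡ = VecP.zipWith-inverseˡ ℤP.+-inverseˡ

-ᵥ-cancel : ∀ {m} (x y : Vec ℤ m) → y +ᵥ (x -ᵥ y) ≡ x
-ᵥ-cancel []      []      = refl
-ᵥ-cancel (a ∷ x) (b ∷ y) = cong₂ _∷_ (scalar a b) (-ᵥ-cancel x y)
  where scalar : ∀ a b → b + (a - b) ≡ a
        scalar = solve-∀

negᵥ-sub : ∀ {m} (x y : Vec ℤ m) → negᵥ (x -ᵥ y) ≡ y -ᵥ x
negᵥ-sub []      []      = refl
negᵥ-sub (a ∷ x) (b ∷ y) = cong₂ _∷_ (scalar a b) (negᵥ-sub x y)
  where scalar : ∀ a b → - (a - b) ≡ b - a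
        scalar = solve-∀

sub-negᵥ : ∀ {m} (x y : Vec ℤ m) → x -ᵥ negᵥ y ≡ x +ᵥ y
sub-negᵥ []      []      = refl
sub-negᵥ (a ∷ x) (b ∷ y) = cong₂ _∷_ (scalar a b) (sub-negᵥ x y)
  where scalar : ∀ a b → a - (- b) ≡ a + b
        scalar = solve-∀

sub-one·ᵥ : ∀ {m} (x y : Vec ℤ m) → x -ᵥ ((+ 1) ·ᵥ y) ≡ x -ᵥ y
sub-one·ᵥ []      []      = refl
sub-one·ᵥ (a ∷ x) (b ∷ y) = cong₂ _∷_ (scalar a b) (sub-one·ᵥ x y)
  where scalar : ∀ a b → a - + 1 * b ≡ a - b
        scalar = solve-∀

sub-two·ᵥ-self : ∀ {m} (x : Vec ℤ m) → x -ᵥ ((+ 2) ·ᵥ x) ≡ negᵥ x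
sub-two·ᵥ-self []      = refl
sub-two·ᵥ-self (a ∷ x) = cong₂ _∷_ (scalar a) (sub-two·ᵥ-self x)
  where scalar : ∀ a → a - + 2 * a ≡ - a
        scalar = solve-∀

balance : ∀ {m} {x x' y y' : Vec ℤ m} → x +ᵥ x' ≡ y +ᵥ y' → x' +ᵥ (x -ᵥ y) ≡ y'
balance {x = []}    {[]}      {[]}    {[]}      _  = refl
balance {x = a ∷ x} {a' ∷ x'} {b ∷ y} {b' ∷ y'} eq =
  cong₂ _∷_ (scalar a a' b b' (VecP.∷-injectiveˡ eq)) (balance (VecP.∷-injectiveʳ eq))
  where
  scalar : ∀ a a' b b' → a + a' ≡ b + b' → a' + (a - b) ≡ b'
  scalar a a' b b' e = begin
    a' + (a - b)   ≡⟨ regroup a a' b ⟩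
    (a + a') - b   ≡⟨ cong (_- b) e ⟩
    (b + b') - b   ≡⟨ cancel b b' ⟩
    b'             ∎
    where regroup : ∀ a a' b → a' + (a - b) ≡ (a + a') - b
          regroup = solve-∀
          cancel : ∀ b b' → (b + b') - b ≡ b'
          cancel = solve-∀

-- The two vector identities behind the algebra of a simple reflection
-- s w = w - ⟨w, α^∨⟩ α: it is an involution and it is linear.
reflection-twice : ∀ {m} p (z w : Vec ℤ m) → (z -ᵥ (p ·ᵥ w)) -ᵥ ((- p) ·ᵥ w) ≡ z
reflection-twice p []      []      = refl
reflection-twice p (a ∷ z) (b ∷ w) = cong₂ _∷_ (scalar p a b) (reflection-twice p z w)
  where scalar : ∀ p a b → (a - p * b) - (- p) * b ≡ a
        scalar = solve-∀

reflection-combination : ∀ {m} c p q (u v w : Vec ℤ m) →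
  (u -ᵥ (c ·ᵥ v)) -ᵥ ((p - c * q) ·ᵥ w) ≡ (u -ᵥ (p ·ᵥ w)) -ᵥ (c ·ᵥ (v -ᵥ (q ·ᵥ w)))
reflection-combination c p q []      []      []      = refl
reflection-combination c p q (a ∷ u) (b ∷ v) (f ∷ w) =
  cong₂ _∷_ (scalar c p q a b f) (reflection-combination c p q u v w)
  where scalar : ∀ c p q a b f → (a - c * b) - (p - c * q) * f ≡ (a - p * f) - c * (b - q * f)
        scalar = solve-∀

nonneg-+ᵥ : ∀ {m} {x y : Vec ℤ m} → All (+ 0 ≤_) x → All (+ 0 ≤_) y → All (+ 0 ≤_) (x +ᵥ y)
nonneg-+ᵥ []         []         = []
nonneg-+ᵥ (0≤a ∷ x≥0) (0≤b ∷ y≥0) = ℤP.+-mono-≤ 0≤a 0≤b ∷ nonneg-+ᵥ x≥0 y≥0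

nonneg-sum-zero : ∀ {m} {x y : Vec ℤ m} → All (+ 0 ≤_) x → All (+ 0 ≤_) y → x +ᵥ y ≡ 0ᵥ → x ≡ 0ᵥ
nonneg-sum-zero {x = []}    {[]}    []          []          _  = refl
nonneg-sum-zero {x = a ∷ x} {b ∷ y} (0≤a ∷ x≥0) (0≤b ∷ y≥0) eq =
  cong₂ _∷_ (ℤP.≤-antisym a≤0 0≤a) (nonneg-sum-zero x≥0 y≥0 (VecP.∷-injectiveʳ eq))
  where
  a≤0 : a ≤ + 0
  a≤0 = subst₂ _≤_ (ℤP.+-identityʳ a) (VecP.∷-injectiveˡ eq) (ℤP.+-monoʳ-≤ a 0≤b)

∑≡sum : ∀ {m} (f : Fin m → ℤ) → ∑ f ≡ ℤSum.sum f
∑≡sum {ℕ.zero}  f = refl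
∑≡sum {ℕ.suc m} f = cong (_+_ (f zero)) (∑≡sum (λ i → f (suc i)))

∑-cong : ∀ {m} {f g : Fin m → ℤ} → (∀ i → f i ≡ g i) → ∑ f ≡ ∑ g
∑-cong {f = f} {g} f≗g = trans (∑≡sum f) (trans (ℤSum.sum-cong-≗ f≗g) (sym (∑≡sum g)))

∑-*ˡ : ∀ {m} c (f : Fin m → ℤ) → ∑ (λ i → c * f i) ≡ c * ∑ f
∑-*ˡ c f = trans (∑≡sum (λ i → c * f i))
                 (trans (sym (ℤSum.*-distribˡ-sum c f)) (cong (c *_) (sym (∑≡sum f))))

∑-comm : ∀ {m k} (f : Fin m → Fin k → ℤ) → ∑ (λ i → ∑ (f i)) ≡ ∑ (λ j → ∑ (λ i → f i j))
∑-comm f = begin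
  ∑ (λ i → ∑ (f i))                            ≡⟨ as-sum f ⟩
  ℤSum.sum (λ i → ℤSum.sum (f i))              ≡⟨ ℤSum.∑-comm f ⟩
  ℤSum.sum (λ j → ℤSum.sum (λ i → f i j))      ≡⟨ sym (as-sum (λ j i → f i j)) ⟩
  ∑ (λ j → ∑ (λ i → f i j))                    ∎
  where
  as-sum : ∀ {m k} (h : Fin m → Fin k → ℤ) → ∑ (λ i → ∑ (h i)) ≡ ℤSum.sum (λ i → ℤSum.sum (h i))
  as-sum h = trans (∑-cong (λ i → ∑≡sum (h i))) (∑≡sum (λ i → ℤSum.sum (h i)))

-- dot x w = Σ_i x_i w_i.  Both the pairing of Defs and the invariant form below are
-- dot products, so their linearity is proved once here, by induction on the vector.
dot : ∀ {m} → Vec ℤ m → (Fin m → ℤ) → ℤ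
dot x w = ∑ (λ i → lookup x i * w i)

dot-+ : ∀ {m} (x y : Vec ℤ m) w → dot (x +ᵥ y) w ≡ dot x w + dot y w
dot-+ []      []      w = refl
dot-+ (a ∷ x) (b ∷ y) w =
  trans (cong (_+_ ((a + b) * w zero)) (dot-+ x y (λ i → w (suc i)))) (scalar a b (w zero) _ _)
  where scalar : ∀ a b f s t → (a + b) * f + (s + t) ≡ (a * f + s) + (b * f + t)
        scalar = solve-∀

dot-- : ∀ {m} (x y : Vec ℤ m) w → dot (x -ᵥ y) w ≡ dot x w - dot y w
dot-- []      []      w = refl
dot-- (a ∷ x) (b ∷ y) w =
  trans (cong (_+_ ((a - b) * w zero)) (dot-- x y (λ i → w (suc i)))) (scalar a b (w zero) _ _)
  where scalar : ∀ a b f s t → (a - b) * f + (s - t) ≡ (a * f + s) - (b * f + t)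
        scalar = solve-∀

dot-· : ∀ {m} c (x : Vec ℤ m) w → dot (c ·ᵥ x) w ≡ c * dot x w
dot-· c []      w = sym (ℤP.*-zeroʳ c)
dot-· c (a ∷ x) w =
  trans (cong (_+_ (c * a * w zero)) (dot-· c x (λ i → w (suc i)))) (scalar c a (w zero) _)
  where scalar : ∀ c a f s → c * a * f + c * s ≡ c * (a * f + s)
        scalar = solve-∀

dot-neg : ∀ {m} (x : Vec ℤ m) w → dot (negᵥ x) w ≡ - dot x w
dot-neg []      w = refl
dot-neg (a ∷ x) w =
  trans (cong (_+_ (- a * w zero)) (dot-neg x (λ i → w (suc i)))) (scalar a (w zero) _)
  where scalar : ∀ a f s → - a * f + - s ≡ - (a * f + s)
        scalar = solve-∀

dot-null : ∀ {m} (x : Vec ℤ m) w → (∀ i → lookup x i ≡ + 0) → dot x w ≡ + 0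
dot-null x w x≗0 = begin
  ∑ (λ i → lookup x i * w i) ≡⟨ ∑-cong (λ i → cong (_* w i) (x≗0 i)) ⟩
  ∑ (λ i → + 0 * w i)        ≡⟨ ∑-*ˡ (+ 0) w ⟩
  + 0 * ∑ w                  ≡⟨ ℤP.*-zeroˡ (∑ w) ⟩
  + 0                        ∎

e-suc : ∀ {m} (j : Fin m) → e (suc j) ≡ + 0 ∷ e j
e-suc j = cong (+ 0 ∷_) (VecP.tabulate-cong λ k → cong (λ b → if b then + 1 else + 0) (≟-suc k))
  where
  ≟-suc : ∀ k → ⌊ suc j Fin.≟ suc k ⌋ ≡ ⌊ j Fin.≟ k ⌋
  ≟-suc k with j Fin.≟ k
  ... | yes _ = refl
  ... | no _  = refl

dot-e : ∀ {m} (j : Fin m) w → dot (e j) w ≡ w j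
dot-e zero    w = begin
  + 1 * w zero + dot (tabulate (λ _ → + 0)) (λ i → w (suc i))
    ≡⟨ cong (_+_ (+ 1 * w zero))
            (dot-null (tabulate (λ _ → + 0)) (λ i → w (suc i)) (VecP.lookup∘tabulate (λ _ → + 0))) ⟩
  + 1 * w zero + + 0 ≡⟨ ℤP.+-identityʳ _ ⟩
  + 1 * w zero       ≡⟨ ℤP.*-identityˡ _ ⟩
  w zero             ∎
dot-e (suc j) w = begin
  dot (e (suc j)) w                          ≡⟨ cong (λ v → dot v w) (e-suc j) ⟩
  + 0 * w zero + dot (e j) (λ i → w (suc i)) ≡⟨ cong₂ _+_ (ℤP.*-zeroˡ (w zero)) (dot-e j (λ i → w (suc i))) ⟩
  + 0 + w (suc j)                            ≡⟨ ℤP.+-identityˡ _ ⟩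
  w (suc j)                                  ∎

cofactor : ∀ {m} → (Fin m → ℕ) → Fin m → ℕ
cofactor {ℕ.suc m} f i = ℕProduct.sum (removeAt f i)

cofactor-spec : ∀ {m} (f : Fin m → ℕ) i → f i ℕ.* cofactor f i ≡ ℕProduct.sum f
cofactor-spec {ℕ.suc m} f i = sym (ℕProduct.sum-remove f)

product-pos : ∀ {m} (f : Fin m → ℕ) → (∀ i → 1 ℕ.≤ f i) → 1 ℕ.≤ ℕProduct.sum f
product-pos {ℕ.zero}  f f≥1 = ℕ.s≤s ℕ.z≤n
product-pos {ℕ.suc m} f f≥1 = ℕP.*-mono-≤ (f≥1 zero) (product-pos (λ i → f (suc i)) (λ i → f≥1 (suc i)))

cofactor-pos : ∀ {m} (f : Fin m → ℕ) → (∀ i → 1 ℕ.≤ f i) → ∀ i → 1 ℕ.≤ cofactor f i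
cofactor-pos {ℕ.suc m} f f≥1 i = product-pos (removeAt f i) (λ k → f≥1 (punchIn i k))

-- The invariant form.
module InvariantForm {n : ℕ} (A : Matrix n) (C : IsIrreducibleFiniteCartan n A) where
  open IsIrreducibleFiniteCartan C using (diag; d; d-pos; symmetric; pos-def)

  -- Column weights ε i = ∏_{k≠i} d k (proportional to squared root lengths): since d i · ε i is
  -- the same number L for all i, the relation d i A i j = d j A j i becomes
  -- A i j ε j = A j i ε i.
  L : ℕ
  L = ℕProduct.sum d

  ε : Fin n → ℤ
  ε i = + cofactor d i

  ε-pos : ∀ i → + 0 < ε i
  ε-pos i = +<+ (cofactor-pos d d-pos i)

  d*ε : ∀ i → + d i * ε i ≡ + L
  d*ε i = trans (sym (ℤP.pos-* (d i) (cofactor d i))) (cong +_ (cofactor-spec d i))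

  ε-symmetrises : ∀ i j → A i j * ε j ≡ A j i * ε i
  ε-symmetrises i j = cancel-pos (d>0 i) (cancel-pos (d>0 j) (begin
      + d j * (+ d i * (A i j * ε j)) ≡⟨ regroup (+ d j) (+ d i) (A i j) (ε j) ⟩
      (+ d i * A i j) * (+ d j * ε j) ≡⟨ cong₂ _*_ (symmetric i j) (d*ε j) ⟩
      (+ d j * A j i) * + L           ≡⟨ cong ((+ d j * A j i) *_) (sym (d*ε i)) ⟩
      (+ d j * A j i) * (+ d i * ε i) ≡⟨ sym (regroup (+ d i) (+ d j) (A j i) (ε i)) ⟩
      + d i * (+ d j * (A j i * ε i)) ≡⟨ swap (+ d i) (+ d j) _ ⟩
      + d j * (+ d i * (A j i * ε i)) ∎))
    where
    d>0 : ∀ i → + 0 < + d i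
    d>0 i = +<+ (d-pos i)
    regroup : ∀ x y a b → x * (y * (a * b)) ≡ (y * a) * (x * b)
    regroup = solve-∀
    swap : ∀ x y t → x * (y * t) ≡ y * (x * t)
    swap = solve-∀

  weighted : Vec ℤ n → Fin n → ℤ
  weighted y i = ∑ (λ j → A i j * ε j * lookup y j)

  ⟪_,_⟫ : Vec ℤ n → Vec ℤ n → ℤ
  ⟪ x , y ⟫ = dot x (weighted y)

  -- The form is symmetric because the matrix A i j ε j is.
  ⟪⟫-sym : ∀ x y → ⟪ x , y ⟫ ≡ ⟪ y , x ⟫
  ⟪⟫-sym x y = begin
    ∑ (λ i → x′ i * weighted y i)
      ≡⟨ ∑-cong (λ i → sym (∑-*ˡ (x′ i) (λ j → A i j * ε j * y′ j))) ⟩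
    ∑ (λ i → ∑ (λ j → x′ i * (A i j * ε j * y′ j)))
      ≡⟨ ∑-comm (λ i j → x′ i * (A i j * ε j * y′ j)) ⟩
    ∑ (λ j → ∑ (λ i → x′ i * (A i j * ε j * y′ j)))
      ≡⟨ ∑-cong (λ j → ∑-cong (λ i → exchange (x′ i) (y′ j) (ε-symmetrises i j))) ⟩
    ∑ (λ j → ∑ (λ i → y′ j * (A j i * ε i * x′ i)))
      ≡⟨ ∑-cong (λ j → ∑-*ˡ (y′ j) (λ i → A j i * ε i * x′ i)) ⟩
    ∑ (λ j → y′ j * weighted x j) ∎
    where
    x′ = lookup x
    y′ = lookup y
    exchange : ∀ s t {a b} → a ≡ b → s * (a * t) ≡ t * (b * s)
    exchange s t {a} refl = reorder s t a
      where reorder : ∀ s t a → s * (a * t) ≡ t * (a * s)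
            reorder = solve-∀

  ⟪⟫-+ʳ : ∀ x y z → ⟪ z , x +ᵥ y ⟫ ≡ ⟪ z , x ⟫ + ⟪ z , y ⟫
  ⟪⟫-+ʳ x y z = trans (⟪⟫-sym z (x +ᵥ y))
                       (trans (dot-+ x y (weighted z)) (cong₂ _+_ (⟪⟫-sym x z) (⟪⟫-sym y z)))

  ⟪⟫--ʳ : ∀ x y z → ⟪ z , x -ᵥ y ⟫ ≡ ⟪ z , x ⟫ - ⟪ z , y ⟫
  ⟪⟫--ʳ x y z = trans (⟪⟫-sym z (x -ᵥ y))
                       (trans (dot-- x y (weighted z)) (cong₂ _-_ (⟪⟫-sym x z) (⟪⟫-sym y z)))

  ⟪⟫-·ʳ : ∀ c x z → ⟪ z , c ·ᵥ x ⟫ ≡ c * ⟪ z , x ⟫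
  ⟪⟫-·ʳ c x z = trans (⟪⟫-sym z (c ·ᵥ x))
                       (trans (dot-· c x (weighted z)) (cong (c *_) (⟪⟫-sym x z)))

  ⟪⟫-negʳ : ∀ x z → ⟪ z , negᵥ x ⟫ ≡ - ⟪ z , x ⟫
  ⟪⟫-negʳ x z = trans (⟪⟫-sym z (negᵥ x))
                       (trans (dot-neg x (weighted z)) (cong -_ (⟪⟫-sym x z)))

  ⟪⟫-simple : ∀ z j → ⟪ z , e j ⟫ ≡ pairing A z j * ε j
  ⟪⟫-simple z j = begin
    ⟪ z , e j ⟫                                   ≡⟨ ⟪⟫-sym z (e j) ⟩
    dot (e j) (weighted z)                        ≡⟨ dot-e j (weighted z) ⟩
    ∑ (λ k → A j k * ε k * lookup z k)            ≡⟨ ∑-cong move ⟩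
    ∑ (λ k → ε j * (lookup z k * A k j))          ≡⟨ ∑-*ˡ (ε j) (λ k → lookup z k * A k j) ⟩
    ε j * pairing A z j                           ≡⟨ ℤP.*-comm (ε j) _ ⟩
    pairing A z j * ε j                           ∎
    where
    move : ∀ k → A j k * ε k * lookup z k ≡ ε j * (lookup z k * A k j)
    move k = trans (cong (_* lookup z k) (ε-symmetrises j k)) (reorder (A k j) (ε j) (lookup z k))
      where reorder : ∀ c w t → c * w * t ≡ w * (t * c)
            reorder = solve-∀

  ⟪⟫-simple-self : ∀ j → ⟪ e j , e j ⟫ ≡ + 2 * ε j
  ⟪⟫-simple-self j = trans (⟪⟫-simple (e j) j) (cong (_* ε j) (trans (dot-e j (λ i → A i j)) (diag j)))

  pairing-reflection : ∀ j z k → pairing A (refl-s A j z) k ≡ pairing A z k - pairing A z j * A j k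
  pairing-reflection j z k = begin
    pairing A (refl-s A j z) k
      ≡⟨ dot-- z (p ·ᵥ e j) (λ i → A i k) ⟩
    pairing A z k - dot (p ·ᵥ e j) (λ i → A i k)
      ≡⟨ cong (_-_ (pairing A z k)) (dot-· p (e j) (λ i → A i k)) ⟩
    pairing A z k - p * pairing A (e j) k
      ≡⟨ cong (λ t → pairing A z k - p * t) (dot-e j (λ i → A i k)) ⟩
    pairing A z k - p * A j k ∎
    where p = pairing A z j

  reflection-involutive : ∀ j z → refl-s A j (refl-s A j z) ≡ z
  reflection-involutive j z = begin
    refl-s A j (refl-s A j z)                        ≡⟨ cong (λ c → refl-s A j z -ᵥ (c ·ᵥ e j)) flips ⟩
    (z -ᵥ (p ·ᵥ e j)) -ᵥ ((- p) ·ᵥ e j)              ≡⟨ reflection-twice p z (e j) ⟩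
    z                                                ∎
    where
    p = pairing A z j
    flips : pairing A (refl-s A j z) j ≡ - p
    flips = trans (pairing-reflection j z j) (trans (cong (λ a → p - p * a) (diag j)) (scalar p))
      where scalar : ∀ p → p - p * + 2 ≡ - p
            scalar = solve-∀

  reflection-linear : ∀ j u c v → refl-s A j (u -ᵥ (c ·ᵥ v)) ≡ refl-s A j u -ᵥ (c ·ᵥ refl-s A j v)
  reflection-linear j u c v = begin
    refl-s A j (u -ᵥ (c ·ᵥ v))
      ≡⟨ cong (λ t → (u -ᵥ (c ·ᵥ v)) -ᵥ (t ·ᵥ e j)) pairing-combination ⟩
    (u -ᵥ (c ·ᵥ v)) -ᵥ ((pairing A u j - c * pairing A v j) ·ᵥ e j)
      ≡⟨ reflection-combination c (pairing A u j) (pairing A v j) u v (e j) ⟩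
    refl-s A j u -ᵥ (c ·ᵥ refl-s A j v) ∎
    where
    pairing-combination : pairing A (u -ᵥ (c ·ᵥ v)) j ≡ pairing A u j - c * pairing A v j
    pairing-combination = trans (dot-- u (c ·ᵥ v) _) (cong (_-_ (pairing A u j)) (dot-· c v _))

  ⟪⟫-invariant : ∀ j x y → ⟪ refl-s A j x , refl-s A j y ⟫ ≡ ⟪ x , y ⟫
  ⟪⟫-invariant j x y = begin
    ⟪ x -ᵥ (p ·ᵥ α) , y -ᵥ (q ·ᵥ α) ⟫
      ≡⟨ dot-- x (p ·ᵥ α) (weighted (y -ᵥ (q ·ᵥ α))) ⟩
    ⟪ x , y -ᵥ (q ·ᵥ α) ⟫ - ⟪ p ·ᵥ α , y -ᵥ (q ·ᵥ α) ⟫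
      ≡⟨ cong₂ _-_ (expand x) (trans (dot-· p α _) (cong (p *_) (expand α))) ⟩
    (⟪ x , y ⟫ - q * ⟪ x , α ⟫) - p * (⟪ α , y ⟫ - q * ⟪ α , α ⟫)
      ≡⟨ cong₃ (λ a b c → (⟪ x , y ⟫ - q * a) - p * (b - q * c))
               (⟪⟫-simple x j) (trans (⟪⟫-sym α y) (⟪⟫-simple y j)) (⟪⟫-simple-self j) ⟩
    (⟪ x , y ⟫ - q * (p * ε j)) - p * (q * ε j - q * (+ 2 * ε j))
      ≡⟨ scalar ⟪ x , y ⟫ p q (ε j) ⟩
    ⟪ x , y ⟫ ∎
    where
    α = e j
    p = pairing A x j
    q = pairing A y j
    expand : ∀ z → ⟪ z , y -ᵥ (q ·ᵥ α) ⟫ ≡ ⟪ z , y ⟫ - q * ⟪ z , α ⟫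
    expand z = trans (⟪⟫--ʳ y (q ·ᵥ α) z) (cong (_-_ ⟪ z , y ⟫) (⟪⟫-·ʳ q α z))
    cong₃ : ∀ {a b c a′ b′ c′ : ℤ} (f : ℤ → ℤ → ℤ → ℤ) →
            a ≡ a′ → b ≡ b′ → c ≡ c′ → f a b c ≡ f a′ b′ c′
    cong₃ f refl refl refl = refl
    scalar : ∀ b p q t → (b - q * (p * t)) - p * (q * t - q * (+ 2 * t)) ≡ b
    scalar = solve-∀

  -- Positive definiteness, transported from the symmetrisation d i A i j along the
  -- substitution v i = ε i u i (which multiplies the form by L).
  ⟪⟫-posdef : ∀ u → u ≢ 0ᵥ → + 0 < ⟪ u , u ⟫
  ⟪⟫-posdef u u≢0 =
    ℤP.*-cancelˡ-<-nonNeg (+ L) (subst₂ _<_ (sym (ℤP.*-zeroʳ (+ L))) rescaled (pos-def v v≢0))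
    where
    v : Vec ℤ n
    v = tabulate (λ i → ε i * lookup u i)
    v-coord : ∀ i → lookup v i ≡ ε i * lookup u i
    v-coord = VecP.lookup∘tabulate _
    v≢0 : v ≢ 0ᵥ
    v≢0 v≡0 = u≢0 (vext λ i → cancel-pos (ε-pos i) (begin
      ε i * lookup u i  ≡⟨ sym (v-coord i) ⟩
      lookup v i        ≡⟨ cong (λ w → lookup w i) v≡0 ⟩
      lookup 0ᵥ i       ≡⟨ VecP.lookup-replicate i (+ 0) ⟩
      + 0               ≡⟨ sym (ℤP.*-zeroʳ (ε i)) ⟩
      ε i * + 0         ≡⟨ cong (ε i *_) (sym (VecP.lookup-replicate i (+ 0))) ⟩
      ε i * lookup 0ᵥ i ∎))
    term : ∀ i j → lookup v i * + d i * A i j * lookup v j ≡ + L * (lookup u i * (A i j * ε j * lookup u j))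
    term i j = begin
      lookup v i * + d i * A i j * lookup v j
        ≡⟨ cong₂ (λ a b → a * + d i * A i j * b) (v-coord i) (v-coord j) ⟩
      ε i * lookup u i * + d i * A i j * (ε j * lookup u j)
        ≡⟨ reorder (ε i) (lookup u i) (+ d i) (A i j) (ε j) (lookup u j) ⟩
      (+ d i * ε i) * (lookup u i * (A i j * ε j * lookup u j))
        ≡⟨ cong (_* (lookup u i * (A i j * ε j * lookup u j))) (d*ε i) ⟩
      + L * (lookup u i * (A i j * ε j * lookup u j)) ∎
      where reorder : ∀ w x δ a w′ y → w * x * δ * a * (w′ * y) ≡ (δ * w) * (x * (a * w′ * y))
            reorder = solve-∀
    rescaled : ∑ (λ i → ∑ (λ j → lookup v i * + d i * A i j * lookup v j)) ≡ + L * ⟪ u , u ⟫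
    rescaled = begin
      ∑ (λ i → ∑ (λ j → lookup v i * + d i * A i j * lookup v j))
        ≡⟨ ∑-cong (λ i → ∑-cong (term i)) ⟩
      ∑ (λ i → ∑ (λ j → + L * (lookup u i * (A i j * ε j * lookup u j))))
        ≡⟨ ∑-cong (λ i → trans (∑-*ˡ (+ L) (λ j → lookup u i * (A i j * ε j * lookup u j)))
                                 (cong (+ L *_) (∑-*ˡ (lookup u i) (λ j → A i j * ε j * lookup u j)))) ⟩
      ∑ (λ i → + L * (lookup u i * weighted u i))
        ≡⟨ ∑-*ˡ (+ L) (λ i → lookup u i * weighted u i) ⟩
      + L * ⟪ u , u ⟫ ∎

module RootGeometry {n : ℕ} (A : Matrix n) (C : IsIrreducibleFiniteCartan n A) where
  open InvariantForm A C

  -- By induction on the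
  -- construction of y, conjugating by a simple reflection.
  reflection-in-root : ∀ {y} → Root A y → ∀ z →
    ∃[ c ] ((+ 2 * ⟪ z , y ⟫ ≡ c * ⟪ y , y ⟫) × (Root A z → Root A (z -ᵥ (c ·ᵥ y))))
  reflection-in-root (simple i) z = pairing A z i , coefficient , reflect i z
    where
    coefficient : + 2 * ⟪ z , e i ⟫ ≡ pairing A z i * ⟪ e i , e i ⟫
    coefficient = begin
      + 2 * ⟪ z , e i ⟫                ≡⟨ cong (+ 2 *_) (⟪⟫-simple z i) ⟩
      + 2 * (pairing A z i * ε i)      ≡⟨ scalar (pairing A z i) (ε i) ⟩
      pairing A z i * (+ 2 * ε i)      ≡⟨ cong (pairing A z i *_) (sym (⟪⟫-simple-self i)) ⟩
      pairing A z i * ⟪ e i , e i ⟫    ∎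
      where scalar : ∀ p t → + 2 * (p * t) ≡ p * (+ 2 * t)
            scalar = solve-∀
  reflection-in-root (reflect j y rt) z with reflection-in-root rt (refl-s A j z)
  ... | c , coefficient , reflects = c , coefficient′ , reflects′
    where
    s = refl-s A j
    coefficient′ : + 2 * ⟪ z , s y ⟫ ≡ c * ⟪ s y , s y ⟫
    coefficient′ = begin
      + 2 * ⟪ z , s y ⟫          ≡⟨ cong (+ 2 *_) (sym (⟪⟫-invariant j z (s y))) ⟩
      + 2 * ⟪ s z , s (s y) ⟫    ≡⟨ cong (λ w → + 2 * ⟪ s z , w ⟫) (reflection-involutive j y) ⟩
      + 2 * ⟪ s z , y ⟫          ≡⟨ coefficient ⟩
      c * ⟪ y , y ⟫              ≡⟨ cong (c *_) (sym (⟪⟫-invariant j y y)) ⟩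
      c * ⟪ s y , s y ⟫          ∎
    reflects′ : Root A z → Root A (z -ᵥ (c ·ᵥ s y))
    reflects′ rz = subst (Root A) conjugate (reflect j _ (reflects (reflect j z rz)))
      where conjugate : s (s z -ᵥ (c ·ᵥ y)) ≡ z -ᵥ (c ·ᵥ s y)
            conjugate = trans (reflection-linear j (s z) c y) (cong (_-ᵥ (c ·ᵥ s y)) (reflection-involutive j z))

  root-norm-pos : ∀ {y} → Root A y → + 0 < ⟪ y , y ⟫
  root-norm-pos (simple i)       = subst (+ 0 <_) (sym (⟪⟫-simple-self i))
                                         (ℤP.*-monoˡ-<-pos (+ 2) {+ 0} (ε-pos i))
  root-norm-pos (reflect j y ry) = subst (+ 0 <_) (sym (⟪⟫-invariant j y y)) (root-norm-pos ry)

  root-nonzero : ∀ {y} → Root A y → y ≢ 0ᵥ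
  root-nonzero ry refl =
    ℤP.<-irrefl (sym (dot-null 0ᵥ (weighted 0ᵥ) (λ i → VecP.lookup-replicate i (+ 0)))) (root-norm-pos ry)

  -- Δ = -Δ: the reflection in y sends y to -y.
  root-neg : ∀ {y} → Root A y → Root A (negᵥ y)
  root-neg {y} ry with reflection-in-root ry y
  ... | c , coefficient , reflects =
    subst (Root A) (trans (cong (λ t → y -ᵥ (t ·ᵥ y)) c≡2) (sub-two·ᵥ-self y)) (reflects ry)
    where c≡2 : c ≡ + 2
          c≡2 = sym (ℤP.*-cancelʳ-≡ (+ 2) c ⟪ y , y ⟫ {{ℤ.>-nonZero (root-norm-pos ry)}} coefficient)

  -- Both reflection coefficients are
  -- positive; if one equals 1 the corresponding reflection yields ±(x - y).  Otherwise
  -- ⟪x,y⟫ ≥ ⟪x,x⟫ and ⟪x,y⟫ ≥ ⟪y,y⟫, so ⟪x-y, x-y⟫ ≤ 0, contradicting definiteness.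
  root-difference : ∀ {x y} → Root A x → Root A y → + 0 < ⟪ x , y ⟫ → x ≢ y → Root A (x -ᵥ y)
  root-difference {x} {y} rx ry 0<⟪x,y⟫ x≢y = decide (p ℤ.≟ + 1) (q ℤ.≟ + 1)
    where
    p q : ℤ
    p = proj₁ (reflection-in-root ry x)
    q = proj₁ (reflection-in-root rx y)
    p-coefficient : + 2 * ⟪ x , y ⟫ ≡ p * ⟪ y , y ⟫
    p-coefficient = proj₁ (proj₂ (reflection-in-root ry x))
    q-coefficient : + 2 * ⟪ x , y ⟫ ≡ q * ⟪ x , x ⟫
    q-coefficient = trans (cong (+ 2 *_) (⟪⟫-sym x y)) (proj₁ (proj₂ (reflection-in-root rx y)))
    x-p·y : Root A (x -ᵥ (p ·ᵥ y))
    x-p·y = proj₂ (proj₂ (reflection-in-root ry x)) rx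
    y-q·x : Root A (y -ᵥ (q ·ᵥ x))
    y-q·x = proj₂ (proj₂ (reflection-in-root rx y)) ry
    decide : Dec (p ≡ + 1) → Dec (q ≡ + 1) → Root A (x -ᵥ y)
    decide (yes p≡1) _ = subst (Root A) (trans (cong (λ t → x -ᵥ (t ·ᵥ y)) p≡1) (sub-one·ᵥ x y)) x-p·y
    decide (no _) (yes q≡1) = subst (Root A) (trans (cong (λ t → negᵥ (y -ᵥ (t ·ᵥ x))) q≡1)
                                                     (trans (cong negᵥ (sub-one·ᵥ y x)) (negᵥ-sub y x)))
                                      (root-neg y-q·x)
    decide (no p≢1) (no q≢1) = ⊥-elim (ℤP.<-irrefl refl (ℤP.<-≤-trans (⟪⟫-posdef (x -ᵥ y) x-y≢0) nonpositive))
      where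
      y≤xy : ⟪ y , y ⟫ ≤ ⟪ x , y ⟫
      y≤xy = coefficient-bound p (root-norm-pos ry) 0<⟪x,y⟫ p-coefficient p≢1
      x≤xy : ⟪ x , x ⟫ ≤ ⟪ x , y ⟫
      x≤xy = coefficient-bound q (root-norm-pos rx) 0<⟪x,y⟫ q-coefficient q≢1
      x-y≢0 : x -ᵥ y ≢ 0ᵥ
      x-y≢0 eq = x≢y (trans (sym (-ᵥ-cancel x y)) (trans (cong (y +ᵥ_) eq) (VecP.zipWith-identityʳ ℤP.+-identityʳ y)))
      expansion : ⟪ x -ᵥ y , x -ᵥ y ⟫ ≡ (⟪ x , x ⟫ - ⟪ x , y ⟫) + (⟪ y , y ⟫ - ⟪ x , y ⟫)
      expansion = begin
        ⟪ x -ᵥ y , x -ᵥ y ⟫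
          ≡⟨ dot-- x y (weighted (x -ᵥ y)) ⟩
        ⟪ x , x -ᵥ y ⟫ - ⟪ y , x -ᵥ y ⟫
          ≡⟨ cong₂ _-_ (⟪⟫--ʳ x y x) (trans (⟪⟫--ʳ x y y) (cong (_- ⟪ y , y ⟫) (⟪⟫-sym y x))) ⟩
        (⟪ x , x ⟫ - ⟪ x , y ⟫) - (⟪ x , y ⟫ - ⟪ y , y ⟫)
          ≡⟨ scalar ⟪ x , x ⟫ ⟪ x , y ⟫ ⟪ y , y ⟫ ⟩
        (⟪ x , x ⟫ - ⟪ x , y ⟫) + (⟪ y , y ⟫ - ⟪ x , y ⟫) ∎
        where scalar : ∀ a c b → (a - c) - (c - b) ≡ (a - c) + (b - c)
              scalar = solve-∀
      nonpositive : ⟪ x -ᵥ y , x -ᵥ y ⟫ ≤ + 0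
      nonpositive = subst (_≤ + 0) (sym expansion) (ℤP.+-mono-≤ (ℤP.i≤j⇒i-j≤0 x≤xy) (ℤP.i≤j⇒i-j≤0 y≤xy))

  root-sum : ∀ {x y} → Root A x → Root A y → ⟪ x , y ⟫ < + 0 → x ≢ negᵥ y → Root A (x +ᵥ y)
  root-sum {x} {y} rx ry ⟪x,y⟫<0 x≢-y =
    subst (Root A) (sub-negᵥ x y)
      (root-difference rx (root-neg ry) (subst (+ 0 <_) (sym (⟪⟫-negʳ y x)) (ℤP.neg-mono-< ⟪x,y⟫<0)) x≢-y)

  positive-sum-nonzero : ∀ {x y} → Positive A x → Positive A y → x +ᵥ y ≢ 0ᵥ
  positive-sum-nonzero (rx , x≥0) (_ , y≥0) x+y≡0 = root-nonzero rx (nonneg-sum-zero x≥0 y≥0 x+y≡0)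

  -- With σ = α + β + γ: if ⟪σ,α⟫ > 0 or ⟪σ,β⟫ > 0, subtract α or β from σ.
  -- Otherwise ⟪σ, α+β⟫ ≤ 0 forces ⟪γ, α+β⟫ < 0, so ⟪γ,α⟫ < 0 or ⟪γ,β⟫ < 0.
  three-root-lemma : ∀ {α β γ} → Positive A α → Positive A β → Positive A γ →
    Root A (α +ᵥ β) → Root A ((α +ᵥ β) +ᵥ γ) → Root A (α +ᵥ γ) ⊎ Root A (β +ᵥ γ)
  three-root-lemma {α} {β} {γ} pα pβ pγ rτ rσ = decide (+ 0 ℤP.<? ⟪ σ , α ⟫) (+ 0 ℤP.<? ⟪ σ , β ⟫)
    where
    τ = α +ᵥ β
    σ = τ +ᵥ γ
    σ-α : σ -ᵥ α ≡ β +ᵥ γ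
    σ-α = trans (cong (_-ᵥ α) (+ᵥ-assoc α β γ)) (+ᵥ-cancelˡ α (β +ᵥ γ))
    σ-β : σ -ᵥ β ≡ α +ᵥ γ
    σ-β = trans (cong (λ w → (w +ᵥ γ) -ᵥ β) (+ᵥ-comm α β))
                (trans (cong (_-ᵥ β) (+ᵥ-assoc β α γ)) (+ᵥ-cancelˡ β (α +ᵥ γ)))
    -- σ differs from α and from β, since β + γ and α + γ are nonzero.
    σ≢ : ∀ {ρ ρ′} → Positive A ρ′ → σ -ᵥ ρ ≡ ρ′ +ᵥ γ → σ ≢ ρ
    σ≢ {ρ} pρ′ σ-ρ σ≡ρ = positive-sum-nonzero pρ′ pγ (trans (sym σ-ρ) (trans (cong (_-ᵥ ρ) σ≡ρ) (-ᵥ-self ρ)))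
    γ≢-  : ∀ {ρ} → Positive A ρ → γ ≢ negᵥ ρ
    γ≢- {ρ} pρ γ≡-ρ = positive-sum-nonzero pγ pρ (trans (cong (_+ᵥ ρ) γ≡-ρ) (negᵥ-inverseˡ ρ))
    via-sum : ∀ {ρ} → Positive A ρ → ⟪ γ , ρ ⟫ < + 0 → Root A (ρ +ᵥ γ)
    via-sum {ρ} pρ h = subst (Root A) (+ᵥ-comm γ ρ) (root-sum (proj₁ pγ) (proj₁ pρ) h (γ≢- pρ))
    decide : Dec (+ 0 < ⟪ σ , α ⟫) → Dec (+ 0 < ⟪ σ , β ⟫) → Root A (α +ᵥ γ) ⊎ Root A (β +ᵥ γ)
    decide (yes h) _       = inj₂ (subst (Root A) σ-α (root-difference rσ (proj₁ pα) h (σ≢ pβ σ-α)))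
    decide (no _)  (yes h) = inj₁ (subst (Root A) σ-β (root-difference rσ (proj₁ pβ) h (σ≢ pα σ-β)))
    decide (no h₁) (no h₂) = Sum.map (via-sum pα) (via-sum pβ) (negative-summand _ _ ⟪γ,τ⟫<0)
      where
      ⟪σ,τ⟫≤0 : ⟪ τ , τ ⟫ + ⟪ γ , τ ⟫ ≤ + 0
      ⟪σ,τ⟫≤0 = subst (_≤ + 0) (trans (sym (⟪⟫-+ʳ α β σ)) (dot-+ τ γ (weighted τ)))
                       (ℤP.+-mono-≤ (ℤP.≮⇒≥ h₁) (ℤP.≮⇒≥ h₂))
      ⟪γ,τ⟫<0 : ⟪ γ , α ⟫ + ⟪ γ , β ⟫ < + 0
      ⟪γ,τ⟫<0 = subst (_< + 0) (⟪⟫-+ʳ α β γ) (negative-complement (root-norm-pos rτ) ⟪σ,τ⟫≤0)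

module CompatibleGrading {n : ℕ} (A : Matrix n) (C : IsIrreducibleFiniteCartan n A)
                         (g : Vec ℤ n → ℤ) (grading : IsGrading A g) (compat : IsCompatible A g) where
  open RootGeometry A C using (root-neg)

  degree-nonneg : ∀ {γ} → Positive A γ → + 0 ≤ g γ
  degree-nonneg = proj₁ compat _

  positive-of-degree : ∀ {γ} → Root A γ → + 0 < g γ → Positive A γ
  positive-of-degree rγ 0<gγ = proj₁ (proj₂ compat) _ rγ (ℤP.i<j⇒suc[i]≤j 0<gγ)

  degree-zero-sign : ∀ {γ} → Deg A g (+ 0) γ → Positive A γ ⊎ Positive A (negᵥ γ)
  degree-zero-sign {γ} γ∈Δ₀ = Sum.map proj₂ proj₂ (Δ₀-split compat γ γ∈Δ₀)
    where
    Δ₀-split : IsCompatible A g → ∀ γ → Deg A g (+ 0) γ →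
               (Deg A g (+ 0) γ × Positive A γ) ⊎ (Deg A g (+ 0) (negᵥ γ) × Positive A (negᵥ γ))
    Δ₀-split (_ , _ , _ , _ , split , _) = split

  degree-antisym : ∀ {x y} → Root A x → Root A y → Root A (x -ᵥ y) → g (y -ᵥ x) ≡ - g (x -ᵥ y)
  degree-antisym {x} {y} rx ry rx-y = begin
    g (y -ᵥ x)                     ≡⟨ scalar (g x) (g (y -ᵥ x)) ⟩
    (g x + g (y -ᵥ x)) - g x       ≡⟨ cong (_- g x) (sym gy) ⟩
    g y - g x                      ≡⟨ cong (_-_ (g y)) gx ⟩
    g y - (g y + g (x -ᵥ y))       ≡⟨ scalar′ (g y) (g (x -ᵥ y)) ⟩
    - g (x -ᵥ y)                   ∎
    where
    ry-x : Root A (y -ᵥ x)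
    ry-x = subst (Root A) (negᵥ-sub x y) (root-neg rx-y)
    additivity : ∀ {u v} → Root A u → Root A v → Root A (v -ᵥ u) → g v ≡ g u + g (v -ᵥ u)
    additivity {u} {v} ru rv rv-u = trans (cong g (sym (-ᵥ-cancel v u)))
      (grading u (v -ᵥ u) ru rv-u (subst (Root A) (sym (-ᵥ-cancel v u)) rv))
    gx = additivity ry rx rx-y
    gy = additivity rx ry ry-x
    scalar : ∀ a b → b ≡ (a + b) - a
    scalar = solve-∀
    scalar′ : ∀ a b → a - (a + b) ≡ - b
    scalar′ = solve-∀

  difference-sign : ∀ {x y} → Root A x → Root A y → Root A (x -ᵥ y) → Positive A (x -ᵥ y) ⊎ Positive A (y -ᵥ x)
  difference-sign {x} {y} rx ry rx-y with ℤP.<-cmp (g (x -ᵥ y)) (+ 0)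
  ... | tri> _ _ 0<g = inj₁ (positive-of-degree rx-y 0<g)
  ... | tri≈ _ g≡0 _ = Sum.map id (subst (Positive A) (negᵥ-sub x y)) (degree-zero-sign (rx-y , g≡0))
  ... | tri< g<0 _ _ = inj₂ (positive-of-degree (subst (Root A) (negᵥ-sub x y) (root-neg rx-y))
                               (subst (+ 0 <_) (sym (degree-antisym rx ry rx-y)) (ℤP.neg-mono-< g<0)))

module GeneratedIdeal {n : ℕ} (A : Matrix n) (C : IsIrreducibleFiniteCartan n A)
                      (g : Vec ℤ n → ℤ) (grading : IsGrading A g) (compat : IsCompatible A g)
                      (I : Pred n) (lower : IsLowerIdeal A g I) where
  open InvariantForm A C
  open RootGeometry A C
  open CompatibleGrading A C g grading compat

  power-degree : ∀ k {γ} → IPow A I k γ → Deg A g (+ ℕ.suc k) γ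
  power-degree ℕ.zero    γ∈I = proj₁ lower _ γ∈I
  power-degree (ℕ.suc k) (α , β , α∈I , β∈Iᵏ , refl , rγ) with power-degree 0 α∈I | power-degree k β∈Iᵏ
  ... | rα , gα | rβ , gβ = rγ , trans (grading α β rα rβ rγ) (cong₂ _+_ gα gβ)

  power-positive : ∀ k {γ} → IPow A I k γ → Positive A γ
  power-positive k γ∈Iᵏ with power-degree k γ∈Iᵏ
  ... | rγ , gγ = positive-of-degree rγ (subst (+ 0 <_) (sym gγ) (+<+ (ℕ.s≤s ℕ.z≤n)))

  generated-positive : ∀ {γ} → Gen A I γ → Positive A γ
  generated-positive (k , γ∈Iᵏ) = power-positive k γ∈Iᵏ

  -- ⟨I⟩ is closed.  For γ₁ = α + β with α ∈ I and β ∈ I^k, the three-root lemma lets us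
  -- add γ₂ first to α or to β, and induction on k absorbs the rest.
  power-closed : ∀ a {γ₁ γ₂} → IPow A I a γ₁ → Gen A I γ₂ → Root A (γ₁ +ᵥ γ₂) → Gen A I (γ₁ +ᵥ γ₂)
  power-closed ℕ.zero    γ₁∈I (b , γ₂∈Iᵇ) r = ℕ.suc b , _ , _ , γ₁∈I , γ₂∈Iᵇ , refl , r
  power-closed (ℕ.suc a) {γ₂ = γ₂} (α , β , α∈I , β∈Iᵃ , refl , rα+β) γ₂∈⟨I⟩@(b , γ₂∈Iᵇ) r =
    [ add-to-α , add-to-β ]′
      (three-root-lemma (power-positive 0 α∈I) (power-positive a β∈Iᵃ) (generated-positive γ₂∈⟨I⟩) rα+β r)
    where
    regroup : β +ᵥ (α +ᵥ γ₂) ≡ (α +ᵥ β) +ᵥ γ₂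
    regroup = trans (sym (+ᵥ-assoc β α γ₂)) (cong (_+ᵥ γ₂) (+ᵥ-comm β α))
    -- α + γ₂ ∈ I^(b+2), then add β by induction.
    add-to-α : Root A (α +ᵥ γ₂) → Gen A I ((α +ᵥ β) +ᵥ γ₂)
    add-to-α rα+γ₂ = subst (Gen A I) regroup
      (power-closed a β∈Iᵃ (ℕ.suc b , α , γ₂ , α∈I , γ₂∈Iᵇ , refl , rα+γ₂) (subst (Root A) (sym regroup) r))
    -- β + γ₂ ∈ ⟨I⟩ by induction, then add α ∈ I.
    add-to-β : Root A (β +ᵥ γ₂) → Gen A I ((α +ᵥ β) +ᵥ γ₂)
    add-to-β rβ+γ₂ with power-closed a β∈Iᵃ γ₂∈⟨I⟩ rβ+γ₂
    ... | m , β+γ₂∈Iᵐ = ℕ.suc m , α , β +ᵥ γ₂ , α∈I , β+γ₂∈Iᵐ , +ᵥ-assoc α β γ₂ , r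

  generated-closed : Closed A (Gen A I)
  generated-closed γ₁ γ₂ (a , γ₁∈Iᵃ) γ₂∈⟨I⟩ = power-closed a γ₁∈Iᵃ γ₂∈⟨I⟩

  Outside : Pred n
  Outside γ = Positive A γ × ¬ Gen A I γ

  Unsplittable : ℕ → Set
  Unsplittable k = ∀ {u v} → Outside u → Outside v → ¬ IPow A I k (u +ᵥ v)

  -- For I itself: the degrees of u and v are 0 and 1, and the summand of degree 1 lies
  -- below u + v, hence in the lower ideal I.
  unsplittable-I : Unsplittable 0
  unsplittable-I {u} {v} (pu , u∉) (pv , v∉) u+v∈I with power-degree 0 u+v∈I
  ... | ru+v , gu+v with split-one (degree-nonneg pu) (degree-nonneg pv)
                                   (trans (sym (grading u v (proj₁ pu) (proj₁ pv) ru+v)) gu+v)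
  ... | inj₁ (_ , gv≡1) = v∉ (0 , proj₂ lower _ v u+v∈I (proj₁ pv , gv≡1)
                                    (subst (All (+ 0 ≤_)) (sym (+ᵥ-cancelʳ u v)) (proj₂ pu)))
  ... | inj₂ (gu≡1 , _) = u∉ (0 , proj₂ lower _ u u+v∈I (proj₁ pu , gu≡1)
                                    (subst (All (+ 0 ≤_)) (sym (+ᵥ-cancelˡ u v)) (proj₂ pv)))

  -- Let x + x′ = y + y′ with x, x′ outside ⟨I⟩, y ∈ I^(a+1), y′ ∈ I^(b+1)
  -- and ⟪x,y⟫ > 0.  Then x - y is a root, positive or negative.  If x - y > 0 it is not
  -- in ⟨I⟩ (else x = y + (x - y) ∈ ⟨I⟩) and y′ = x′ + (x - y) splits; if y - x > 0 it is
  -- not in ⟨I⟩ (else x′ = y′ + (y - x) ∈ ⟨I⟩) and y = x + (y - x) splits.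
  exchange : ∀ a b → Unsplittable a → Unsplittable b →
             ∀ {x x′ y y′} → Outside x → Outside x′ → IPow A I a y → IPow A I b y′ →
             x +ᵥ x′ ≡ y +ᵥ y′ → + 0 < ⟪ x , y ⟫ → ⊥
  exchange a b unsplit-a unsplit-b {x} {x′} {y} {y′} ox@(px , x∉) ox′@(px′ , x′∉) y∈Iᵃ y′∈Iᵇ
           x+x′≡y+y′ 0<⟪x,y⟫ =
    [ x-y-positive , y-x-positive ]′ (difference-sign (proj₁ px) ry rx-y)
    where
    ry : Root A y
    ry = proj₁ (power-positive a y∈Iᵃ)
    rx-y : Root A (x -ᵥ y)
    rx-y = root-difference (proj₁ px) ry 0<⟪x,y⟫ (λ x≡y → x∉ (a , subst (IPow A I a) (sym x≡y) y∈Iᵃ))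
    x-y-positive : Positive A (x -ᵥ y) → ⊥
    x-y-positive px-y = unsplit-b ox′ (px-y , x-y∉) (subst (IPow A I b) (sym (balance x+x′≡y+y′)) y′∈Iᵇ)
      where
      x-y∉ : ¬ Gen A I (x -ᵥ y)
      x-y∉ x-y∈ = x∉ (subst (Gen A I) (-ᵥ-cancel x y)
                       (generated-closed y (x -ᵥ y) (a , y∈Iᵃ) x-y∈ (subst (Root A) (sym (-ᵥ-cancel x y)) (proj₁ px))))
    y-x-positive : Positive A (y -ᵥ x) → ⊥
    y-x-positive py-x = unsplit-a ox (py-x , y-x∉) (subst (IPow A I a) (sym (-ᵥ-cancel y x)) y∈Iᵃ)
      where
      x′≡ : y′ +ᵥ (y -ᵥ x) ≡ x′
      x′≡ = balance (sym x+x′≡y+y′)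
      y-x∉ : ¬ Gen A I (y -ᵥ x)
      y-x∉ y-x∈ = x′∉ (subst (Gen A I) x′≡
                        (generated-closed y′ (y -ᵥ x) (b , y′∈Iᵇ) y-x∈ (subst (Root A) (sym x′≡) (proj₁ px′))))

  -- Induction on k.  If u + v = α + β with α ∈ I, β ∈ I^(k+1), then
  -- 0 < ⟪u+v, α+β⟫ = ⟪u,α⟫ + ⟪u,β⟫ + ⟪v,α⟫ + ⟪v,β⟫, so some term is positive and the
  -- exchange step applies.
  unsplittable : ∀ k → Unsplittable k
  unsplittable ℕ.zero = unsplittable-I
  unsplittable (ℕ.suc k) {u} {v} ou ov (α , β , α∈I , β∈Iᵏ , u+v≡α+β , ru+v) =
    [ [ u-α , u-β ]′ , [ v-α , v-β ]′ ]′
      (Sum.map (positive-summand _ _) (positive-summand _ _) (positive-summand _ _ expansion))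
    where
    expansion : + 0 < (⟪ u , α ⟫ + ⟪ u , β ⟫) + (⟪ v , α ⟫ + ⟪ v , β ⟫)
    expansion = subst (+ 0 <_) (trans (dot-+ u v (weighted (α +ᵥ β))) (cong₂ _+_ (⟪⟫-+ʳ α β u) (⟪⟫-+ʳ α β v)))
                      (subst (λ w → + 0 < ⟪ u +ᵥ v , w ⟫) u+v≡α+β (root-norm-pos ru+v))
    u-α : + 0 < ⟪ u , α ⟫ → ⊥
    u-α = exchange 0 k unsplittable-I (unsplittable k) ou ov α∈I β∈Iᵏ u+v≡α+β
    u-β : + 0 < ⟪ u , β ⟫ → ⊥
    u-β = exchange k 0 (unsplittable k) unsplittable-I ou ov β∈Iᵏ α∈I (trans u+v≡α+β (+ᵥ-comm α β))
    v-α : + 0 < ⟪ v , α ⟫ → ⊥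
    v-α = exchange 0 k unsplittable-I (unsplittable k) ov ou α∈I β∈Iᵏ (trans (+ᵥ-comm v u) u+v≡α+β)
    v-β : + 0 < ⟪ v , β ⟫ → ⊥
    v-β = exchange k 0 (unsplittable k) unsplittable-I ov ou β∈Iᵏ α∈I
                   (trans (+ᵥ-comm v u) (trans u+v≡α+β (+ᵥ-comm α β)))

  complement-closed : Closed A Outside
  complement-closed u v ou@(pu , _) ov@(pv , _) ru+v =
    (ru+v , nonneg-+ᵥ (proj₂ pu) (proj₂ pv)) , λ { (k , u+v∈Iᵏ) → unsplittable k ou ov u+v∈Iᵏ }

theorem3p3 : ∀ (n : ℕ) (A : Matrix n) → IsIrreducibleFiniteCartan n A →
    ∀ (g : Vec ℤ n → ℤ) → IsGrading A g → IsCompatible A g →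
    ∀ (I : Pred n) → IsLowerIdeal A g I →
    IsBiconvex A (Gen A I)
theorem3p3 n A cartan g grading compat I lower =
  (λ _ → generated-positive) , generated-closed , complement-closed
  where open GeneratedIdeal A cartan g grading compat I lower
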